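{- Let $G$ be a subcubic graph of order $n$, $\pi=\{V_1,\dots,V_k\}$ a connected coalition partition of $G$, and $H=CCG(G,\pi)$. If $\alpha(H)=1$, then $H$ is isomorphic to $K_3$ or to the star $S_k$, where $k\le\lfloor (n+7)/3\rfloor$.
   Context: Graphs are finite and simple. A graph is subcubic if it is connected and its maximum vertex degree is at most 3. $G[S]$ is the induced subgraph. A set $D\subseteq V$ is dominating if every vertex of $V\setminus D$ has a neighbour in $D$; connected dominating if moreover $G[D]$ is connected. Two disjoint subsets $A,B\subseteq V$ form a connected coalition if neither is a connected dominating set but $A\cup B$ is. A connected coalition partition of $G$ is a partition $\pi=\{V_1,\dots,V_k\}$ of $V$ such that each $V_i$ either is a connected dominating set consisting of a single vertex or forms a connected coalition with some set of $\pi$. The coalition graph $CCG(G,\pi)$ has vertex set $\{V_1,\dots,V_k\}$, with $V_i\sim V_j$ iff they form a connected coalition. $\alpha(H)$ is the maximum size of a matching in $H$. $S_k$ is the star of order $k$ ($K_{1,k-1}$). -}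

module Defs where

open import Data.Nat using (ℕ; zero; suc; _≤_)
open import Data.Fin using (Fin; toℕ)
open import Data.Bool using (Bool; true; false; if_then_else_)
open import Data.List using (List; map; allFin)
open import Data.Nat.ListAction using (sum)
open import Data.Unit using (⊤)
open import Data.Product using (Σ; _×_; ∃; ∃-syntax; _,_)
open import Data.Sum using (_⊎_)
open import Relation.Nullary using (¬_)
open import Relation.Binary.PropositionalEquality using (_≡_; _≢_)
open import Function.Bundles using (_↔_; _⇔_; Inverse)

record Graph (n : ℕ) : Set where
  field
    adj    : Fin n → Fin n → Bool
    sym    : ∀ u v → adj u v ≡ adj v u
    irrefl : ∀ u → adj u u ≡ false
open Graph public

Adj : ∀ {n} → Graph n → Fin n → Fin n → Set
Adj G u v = adj G u v ≡ true

deg : ∀ {n} → Graph n → Fin n → ℕ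
deg {n} G u = sum (map (λ v → if adj G u v then 1 else 0) (allFin n))

VSet : ℕ → Set₁
VSet n = Fin n → Set

_∪_ : ∀ {n} → VSet n → VSet n → VSet n
(A ∪ B) v = A v ⊎ B v

data WalkIn {n} (G : Graph n) (S : VSet n) : Fin n → Fin n → Set where
  here : ∀ {u} → S u → WalkIn G S u u
  step : ∀ {u w v} → S u → Adj G u w → WalkIn G S w v → WalkIn G S u v

ConnectedIn : ∀ {n} → Graph n → VSet n → Set
ConnectedIn G S = ∀ u v → S u → S v → WalkIn G S u v

Connected : ∀ {n} → Graph n → Set
Connected G = ConnectedIn G (λ _ → ⊤)

Subcubic : ∀ {n} → Graph n → Set
Subcubic G = Connected G × (∀ u → deg G u ≤ 3)

Dominating : ∀ {n} → Graph n → VSet n → Set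
Dominating G D = ∀ v → D v ⊎ (∃[ u ] (D u × Adj G u v))

ConnDom : ∀ {n} → Graph n → VSet n → Set
ConnDom G D = Dominating G D × ConnectedIn G D

ConnCoalition : ∀ {n} → Graph n → VSet n → VSet n → Set
ConnCoalition G A B = ¬ ConnDom G A × ¬ ConnDom G B × ConnDom G (A ∪ B)

record Partition (n k : ℕ) : Set where
  field
    part     : Fin n → Fin k
    nonempty : ∀ i → ∃[ v ] (part v ≡ i)
open Partition public

Block : ∀ {n k} → Partition n k → Fin k → VSet n
Block π i v = part π v ≡ i

Singleton : ∀ {n} → VSet n → Set
Singleton S = ∃[ v ] (∀ w → (S w → w ≡ v) × (w ≡ v → S w))

IsConnCoalitionPartition : ∀ {n k} → Graph n → Partition n k → Set
IsConnCoalitionPartition G π =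
  ∀ i → (ConnDom G (Block π i) × Singleton (Block π i))
      ⊎ (∃[ j ] ConnCoalition G (Block π i) (Block π j))

CCG : ∀ {n k} → Graph n → Partition n k → Fin k → Fin k → Set
CCG G π i j = ConnCoalition G (Block π i) (Block π j)

IsMatching : ∀ {k} → (Fin k → Fin k → Set) → (m : ℕ) → (Fin m → Fin k × Fin k) → Set
IsMatching E m e =
  (∀ t → let (a , b) = e t in E a b)
  × (∀ t t' → t ≢ t' → let (a , b) = e t in let (c , d) = e t' in
       a ≢ c × a ≢ d × b ≢ c × b ≢ d)

HasMatching : ∀ {k} → (Fin k → Fin k → Set) → ℕ → Set
HasMatching E m = Σ (Fin _ → _) (IsMatching E m)

-- α(H) = a : a is the maximum size of a matching of H
MatchingNumber : ∀ {k} → (Fin k → Fin k → Set) → ℕ → Set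
MatchingNumber E a = HasMatching E a × (∀ m → HasMatching E m → m ≤ a)

Iso : ∀ {a b} → (Fin a → Fin a → Set) → (Fin b → Fin b → Set) → Set
Iso {a} {b} E F = Σ (Fin a ↔ Fin b) λ f →
  ∀ i j → E i j ⇔ F (Inverse.to f i) (Inverse.to f j)

K : (m : ℕ) → Fin m → Fin m → Set
K m i j = i ≢ j

Star : (m : ℕ) → Fin m → Fin m → Set
Star m i j = i ≢ j × (toℕ i ≡ 0 ⊎ toℕ j ≡ 0)

{-# OPTIONS --safe #-}
module Submission where

-- Every block of π lies in a coalition: a singleton connected dominating block {v} makes v adjacent to
-- all other vertices, so G has at most four vertices, and then one block of any coalition is already
-- connected dominating. Hence H has an edge, no isolated vertex and no two disjoint edges, which forces
-- a triangle or a star. For a star with centre C and leaves L₁, …, Lₘ, C is not connected dominating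
-- while every C ∪ Lⱼ is. If C fails to dominate some x, then x has a neighbour in every Lⱼ, so m ≤ 3
-- and m + 2 ≤ n. Otherwise G[C] is disconnected, and for two of its components K₁, K₂ the connected set
-- C ∪ Lⱼ gives every Lⱼ a vertex next to K₁ and one next to K₂. In a subcubic graph a connected set K
-- has at most |K| + 2 neighbours outside it (a spanning tree uses 2(|K| − 1) of the 3|K| edge ends),
-- so m ≤ |Kᵢ| + 2, while |K₁| + |K₂| + m ≤ n. Either way 3m ≤ n + 4, that is, k = m + 1 ≤ ⌊(n + 7)/3⌋.

open import Defs hiding (sym)
open import Data.Bool using (Bool; true; false; if_then_else_)
open import Data.Bool.Properties using () renaming (_≟_ to _≟ᵇ_)
open import Data.Empty using (⊥; ⊥-elim)
open import Data.Fin using (Fin; zero; suc; toℕ; punchIn; _≟_)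
open import Data.Fin.Permutation using (transpose)
import Data.Fin.Permutation.Components as PC
open import Data.Fin.Properties using (any?; all?; ¬∀⟶∃¬; toℕ-injective; punchIn-injective; punchInᵢ≢i)
open import Data.List using (List; []; _∷_; _++_; length; filter; map; allFin; lookup; tabulate)
open import Data.List.Properties using (filter-notAll; length-tabulate; length-++)
open import Data.List.Membership.Propositional using (_∈_; _∉_)
open import Data.List.Membership.Propositional.Properties using (∈-++⁻; ∈-filter⁺; ∈-filter⁻; ∈-allFin)
open import Data.List.Relation.Binary.Disjoint.Propositional using (Disjoint)
open import Data.List.Relation.Binary.Subset.Propositional using (_⊆_)
open import Data.List.Relation.Binary.Subset.Propositional.Properties using (Any-resp-⊆)
open import Data.List.Relation.Unary.All as All using (All; []; _∷_)
open import Data.List.Relation.Unary.All.Properties using (¬Any⇒All¬) renaming (tabulate⁺ to All-tabulate⁺)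
open import Data.List.Relation.Unary.Any as Any using (Any; here; there)
open import Data.List.Relation.Unary.Any.Properties using (lookup-index)
open import Data.List.Relation.Unary.Unique.Propositional using (Unique; []; _∷_)
open import Data.List.Relation.Unary.Unique.Propositional.Properties using (filter⁺; tabulate⁺; ++⁺)
open import Data.Nat using (zero; suc; _+_; _*_; _≤_; z≤n; s≤s; s≤s⁻¹)
open import Data.Nat.DivMod using (_/_; m*n/n≡m; /-monoˡ-≤)
open import Data.Nat.ListAction using (sum)
open import Data.Nat.Properties
  using (≤-refl; ≤-reflexive; ≤-trans; ≤-<-trans; <⇒≱; +-assoc; +-suc; +-identityʳ; +-mono-≤; +-monoˡ-≤; +-monoʳ-≤; module ≤-Reasoning)
open import Data.Nat.Tactic.RingSolver using (solve-∀)
open import Data.Product using (_×_; ∃; ∃-syntax; ∃₂; _,_; proj₁; proj₂)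
open import Data.Sum as Sum using (_⊎_; inj₁; inj₂; [_,_])
open import Function using (_∘_; id; case_of_)
open import Function.Bundles using (_↔_; _⇔_; Inverse; Injection; Equivalence; mk⇔; mk⤖)
open import Function.Properties.Bijection using (⤖⇒↔)
open import Function.Properties.Inverse using (↔-sym; ↔⇒↣)
open import Relation.Binary.Definitions using (DecidableEquality)
open import Relation.Binary.PropositionalEquality using (_≡_; _≢_; refl; sym; trans; cong; subst)
open import Relation.Nullary using (¬_; Dec; yes; no; does; contradiction)
open import Relation.Nullary.Decidable using (_×-dec_; _⊎-dec_; _→-dec_; ¬?; map′)
open import Relation.Unary using (Decidable)
open import Relation.Unary.Properties using (∁?)

unique-⊆⇒length≤ : ∀ {a} {A : Set a} → DecidableEquality A →
  ∀ {xs ys : List A} → Unique xs → xs ⊆ ys → length xs ≤ length ys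
unique-⊆⇒length≤ _≟ₐ_ {[]}     _            _     = z≤n
unique-⊆⇒length≤ _≟ₐ_ {x ∷ xs} {ys} (x≢xs ∷ xs!) xs⊆ys =
  ≤-<-trans (unique-⊆⇒length≤ _≟ₐ_ xs! xs⊆ys∖x) (filter-notAll (¬? ∘ (x ≟ₐ_)) ys x∈ys)
  where
  xs⊆ys∖x : xs ⊆ filter (¬? ∘ (x ≟ₐ_)) ys
  xs⊆ys∖x y∈xs = ∈-filter⁺ (¬? ∘ (x ≟ₐ_)) (xs⊆ys (there y∈xs)) (All.lookup x≢xs y∈xs)
  x∈ys : Any (λ y → ¬ x ≢ y) ys
  x∈ys = Any.map (λ x≡y x≢y → x≢y x≡y) (xs⊆ys (here refl))

unique⇒length≤ : ∀ {n} {xs : List (Fin n)} → Unique xs → length xs ≤ n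
unique⇒length≤ {n} {xs} xs! = subst (length xs ≤_) (length-tabulate (λ i → i))
  (unique-⊆⇒length≤ _≟_ xs! (λ _ → ∈-allFin _))

sum-indicator≡length-filter : ∀ {a} {A : Set a} (b : A → Bool) (xs : List A) →
  sum (map (λ x → if b x then 1 else 0) xs) ≡ length (filter (λ x → b x ≟ᵇ true) xs)
sum-indicator≡length-filter b []       = refl
sum-indicator≡length-filter b (x ∷ xs) with b x
... | true  = cong suc (sum-indicator≡length-filter b xs)
... | false = sum-indicator≡length-filter b xs

length-filter+filter-∁ : ∀ {a p} {A : Set a} {P : A → Set p} (P? : Decidable P) (xs : List A) →
  length (filter P? xs) + length (filter (∁? P?) xs) ≡ length xs
length-filter+filter-∁ P? []       = refl
length-filter+filter-∁ P? (x ∷ xs) with does (P? x)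
... | true  = cong suc (length-filter+filter-∁ P? xs)
... | false = trans (+-suc _ _) (cong suc (length-filter+filter-∁ P? xs))

module _ {n} (G : Graph n) where

  open import Data.List.Membership.DecPropositional (_≟_ {n = n}) using (_∈?_)

  adj? : ∀ u v → Dec (Adj G u v)
  adj? u v = adj G u v ≟ᵇ true

  Adj-sym : ∀ {u v} → Adj G u v → Adj G v u
  Adj-sym {u} {v} = trans (Graph.sym G v u)

  Adj-irrefl : ∀ {u} → ¬ Adj G u u
  Adj-irrefl {u} uu with trans (sym (Graph.irrefl G u)) uu
  ... | ()

  unique-neighbours⇒length≤deg : ∀ {u xs} → Unique xs → All (Adj G u) xs → length xs ≤ deg G u
  unique-neighbours⇒length≤deg {u} {xs} xs! xs~u =
    subst (length xs ≤_) (sym (sum-indicator≡length-filter (adj G u) (allFin n)))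
      (unique-⊆⇒length≤ _≟_ xs! (λ x∈xs → ∈-filter⁺ (adj? u) (∈-allFin _) (All.lookup xs~u x∈xs)))

  walk-start : ∀ {S u v} → WalkIn G S u v → S u
  walk-start (here s)     = s
  walk-start (step s _ _) = s

  walk-end : ∀ {S u v} → WalkIn G S u v → S v
  walk-end (here s)     = s
  walk-end (step _ _ p) = walk-end p

  walk-mono : ∀ {S T : VSet n} → (∀ {x} → S x → T x) → ∀ {u v} → WalkIn G S u v → WalkIn G T u v
  walk-mono S⊆T (here s)     = here (S⊆T s)
  walk-mono S⊆T (step s a p) = step (S⊆T s) a (walk-mono S⊆T p)

  walk-++ : ∀ {S u v w} → WalkIn G S u v → WalkIn G S v w → WalkIn G S u w
  walk-++ (here _)     q = q
  walk-++ (step s a p) q = step s a (walk-++ p q)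

  walk-snoc : ∀ {S u v w} → WalkIn G S u v → Adj G v w → S w → WalkIn G S u w
  walk-snoc p a s = walk-++ p (step (walk-end p) a (here s))

  walk-reverse : ∀ {S u v} → WalkIn G S u v → WalkIn G S v u
  walk-reverse (here s)     = here s
  walk-reverse (step s a p) = walk-snoc (walk-reverse p) (Adj-sym a) s

  walk-exit : ∀ {S P Q : VSet n} → Decidable Q → (∀ {p q} → P p → Adj G p q → Q q → P q) →
    ∀ {u v} → WalkIn G S u v → P u → ¬ P v → ∃₂ λ p q → P p × Adj G p q × S q × ¬ Q q
  walk-exit Q? closed (here _) Pu ¬Pv = contradiction Pu ¬Pv
  walk-exit Q? closed {u} (step {w = w} _ a p) Pu ¬Pv with Q? w
  ... | yes Qw = walk-exit Q? closed p (closed Pu a Qw) ¬Pv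
  ... | no ¬Qw = u , w , Pu , a , walk-start p , ¬Qw

  connDom⇒neighbour : ∀ {D x y} → ConnDom G D → D y → x ≢ y → ∃[ w ] (D w × Adj G x w)
  connDom⇒neighbour {x = x} (dom , con) Dy x≢y with dom x
  ... | inj₂ (w , Dw , w~x) = w , Dw , Adj-sym w~x
  ... | inj₁ Dx with con x _ Dx Dy
  ...   | here _                = contradiction refl x≢y
  ...   | step {w = w} _ x~w p = w , walk-start p , x~w

  connDom-≐ : ∀ {S T : VSet n} → (∀ {x} → S x → T x) → (∀ {x} → T x → S x) → ConnDom G S → ConnDom G T
  connDom-≐ {T = T} S⊆T T⊆S (dom , con) = dominating , λ u v Tu Tv → walk-mono S⊆T (con u v (T⊆S Tu) (T⊆S Tv))
    where
    dominating : Dominating G T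
    dominating v with dom v
    ... | inj₁ Sv             = inj₁ (S⊆T Sv)
    ... | inj₂ (u , Su , u~v) = inj₂ (u , S⊆T Su , u~v)

  Without : VSet n → Fin n → VSet n
  Without S x y = S y × y ≢ x

  walk-last-visit : ∀ {S u v} x → WalkIn G S u v →
    WalkIn G (Without S x) u v ⊎ x ≡ v ⊎ ∃[ w ] (Adj G x w × WalkIn G (Without S x) w v)
  walk-last-visit {u = u} x (here s) with u ≟ x
  ... | yes u≡x = inj₂ (inj₁ (sym u≡x))
  ... | no  u≢x = inj₁ (here (s , u≢x))
  walk-last-visit {u = u} x (step {w = w} s a p) with walk-last-visit x p
  ... | inj₂ cut = inj₂ cut
  ... | inj₁ q with u ≟ x
  ...   | yes refl = inj₂ (inj₂ (w , a , q))
  ...   | no  u≢x  = inj₁ (step (s , u≢x) a q)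

  walk-first-step : ∀ {S u v} → WalkIn G S u v → u ≡ v ⊎ ∃[ w ] (Adj G u w × WalkIn G (Without S u) w v)
  walk-first-step {u = u} p with walk-last-visit u p
  ... | inj₁ q   = contradiction refl (proj₂ (walk-start q))
  ... | inj₂ cut = cut

  private
    Unvisited : VSet n → List (Fin n) → VSet n
    Unvisited S R y = S y × y ∉ R

    -- Each recursive call visits a new vertex, so n ≤ fuel + length R keeps the fuel from running out.
    walk?-avoiding : ∀ {S} → Decidable S → ∀ fuel (R : List (Fin n)) → Unique R → n ≤ fuel + length R →
      ∀ x y → Dec (WalkIn G (Unvisited S R) x y)
    walk?-avoiding {S} S? fuel R R! n≤ x y with S? x ×-dec ¬? (x ∈? R)
    ... | no ¬x = no (¬x ∘ walk-start)
    ... | yes x∈ with x ≟ y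
    ...   | yes refl = yes (here x∈)
    walk?-avoiding S? zero R R! n≤ x y | yes (_ , x∉R) | no _ =
      contradiction (unique⇒length≤ (¬Any⇒All¬ R x∉R ∷ R!)) (<⇒≱ (s≤s n≤))
    walk?-avoiding {S} S? (suc fuel) R R! n≤ x y | yes x∈@(_ , x∉R) | no x≢y =
      map′ (λ (w , a , p) → step x∈ a (walk-mono unvisit p)) first-step
        (any? λ w → adj? x w ×-dec walk?-avoiding S? fuel (x ∷ R) x∷R! n≤′ w y)
      where
      x∷R! : Unique (x ∷ R)
      x∷R! = ¬Any⇒All¬ R x∉R ∷ R!
      n≤′ : n ≤ fuel + length (x ∷ R)
      n≤′ = subst (n ≤_) (sym (+-suc fuel (length R))) n≤
      unvisit : ∀ {z} → Unvisited S (x ∷ R) z → Unvisited S R z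
      unvisit (s , z∉x∷R) = s , z∉x∷R ∘ there
      visit : ∀ {z} → Without (Unvisited S R) x z → Unvisited S (x ∷ R) z
      visit ((s , z∉R) , z≢x) = s , λ { (here z≡x) → z≢x z≡x ; (there z∈R) → z∉R z∈R }
      first-step : WalkIn G (Unvisited S R) x y → ∃[ w ] (Adj G x w × WalkIn G (Unvisited S (x ∷ R)) w y)
      first-step p with walk-first-step p
      ... | inj₁ x≡y         = contradiction x≡y x≢y
      ... | inj₂ (w , a , q) = w , a , walk-mono visit q

  walk? : ∀ {S} → Decidable S → ∀ x y → Dec (WalkIn G S x y)
  walk? S? x y = map′ (walk-mono proj₁) (walk-mono (_, λ ()))
    (walk?-avoiding S? n [] [] (≤-reflexive (sym (+-identityʳ n))) x y)

  dominating? : ∀ {S} → Decidable S → Dec (Dominating G S)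
  dominating? S? = all? λ v → S? v ⊎-dec any? λ u → S? u ×-dec adj? u v

  private
    linked? : ∀ {S} → Decidable S → ∀ u v → Dec (S u → S v → WalkIn G S u v)
    linked? S? u v = S? u →-dec (S? v →-dec walk? S? u v)

  connectedIn? : ∀ {S} → Decidable S → Dec (ConnectedIn G S)
  connectedIn? S? = all? λ u → all? (linked? S? u)

  connDom? : ∀ {S} → Decidable S → Dec (ConnDom G S)
  connDom? S? = dominating? S? ×-dec connectedIn? S?

  ¬connDom⇒witness : ∀ {S} → Decidable S → ¬ ConnDom G S →
    (∃[ x ] (¬ S x × (∀ {u} → S u → ¬ Adj G u x))) ⊎ (∃₂ λ u v → S u × S v × ¬ WalkIn G S u v)
  ¬connDom⇒witness {S} S? ¬cd with dominating? S?
  ... | no ¬dom =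
        let x , ¬dom-x = ¬∀⟶∃¬ n _ (λ v → S? v ⊎-dec any? λ u → S? u ×-dec adj? u v) ¬dom
        in inj₁ (x , ¬dom-x ∘ inj₁ , λ Su u~x → ¬dom-x (inj₂ (_ , Su , u~x)))
  ... | yes dom with ¬∀⟶∃¬ n _ (λ u → all? (linked? S? u)) (¬cd ∘ (dom ,_))
  ...   | u , ¬linked-u with ¬∀⟶∃¬ n _ (linked? S? u) ¬linked-u
  ...     | v , ¬linked-uv with S? u | S? v
  ...       | yes Su | yes Sv = inj₂ (u , v , Su , Sv , λ p → ¬linked-uv λ _ _ → p)
  ...       | no ¬Su | _      = contradiction (λ Su → contradiction Su ¬Su) ¬linked-uv
  ...       | yes _  | no ¬Sv = contradiction (λ _ Sv → contradiction Sv ¬Sv) ¬linked-uv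

-- Boundaries of connected sets in subcubic graphs

module Boundary {n} (G : Graph n) (deg≤3 : ∀ u → deg G u ≤ 3) where

  open import Data.List.Membership.DecPropositional (_≟_ {n = n}) using (_∈?_)

  AdjTo : List (Fin n) → VSet n
  AdjTo T z = Any (λ t → Adj G t z) T

  OnBoundary : List (Fin n) → VSet n
  OnBoundary T z = z ∉ T × AdjTo T z

  SmallBoundary : List (Fin n) → Set
  SmallBoundary T = ∀ {Z} → Unique Z → All (OnBoundary T) Z → length Z ≤ length T + 2

  smallBoundary-[_] : ∀ r → SmallBoundary (r ∷ [])
  smallBoundary-[ r ] Z! Z∂ = ≤-trans (unique-neighbours⇒length≤deg G Z! (All.map r~ Z∂)) (deg≤3 r)
    where
    r~ : ∀ {z} → OnBoundary (r ∷ []) z → Adj G r z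
    r~ (_ , here r~z) = r~z

  -- Boundary vertices adjacent to T stay on the boundary; the others are neighbours of w besides t.
  smallBoundary-∷ : ∀ {T w t} → w ∉ T → t ∈ T → Adj G t w → SmallBoundary T → SmallBoundary (w ∷ T)
  smallBoundary-∷ {T} {w} {t} w∉T t∈T t~w small {Z} Z! Z∂ = begin
    length Z                                                  ≡⟨ sym (length-filter+filter-∁ adjTo? Z) ⟩
    length (filter adjTo? Z) + length (filter (∁? adjTo?) Z) ≤⟨ +-mono-≤ (s≤s⁻¹ old) (s≤s⁻¹ new) ⟩
    length T + 1 + 2                                          ≡⟨ +-assoc (length T) 1 2 ⟩
    length T + 3                                              ≡⟨ +-suc (length T) 2 ⟩
    length (w ∷ T) + 2                                        ∎
    where
    open ≤-Reasoning
    adjTo? : Decidable (AdjTo T)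
    adjTo? z = Any.any? (λ t → adj? G t z) T
    Z∉wT : ∀ {z} → z ∈ Z → z ∉ w ∷ T
    Z∉wT z∈Z = proj₁ (All.lookup Z∂ z∈Z)
    old : suc (length (filter adjTo? Z)) ≤ suc (length T + 1)
    old = subst (suc (length (filter adjTo? Z)) ≤_) (+-suc (length T) 1)
      (small (All.tabulate w≢ ∷ filter⁺ adjTo? Z!) (w∂ ∷ All.tabulate z∂))
      where
      w≢ : ∀ {z} → z ∈ filter adjTo? Z → w ≢ z
      w≢ z∈ refl = Z∉wT (proj₁ (∈-filter⁻ adjTo? z∈)) (here refl)
      w∂ : OnBoundary T w
      w∂ = w∉T , Any.map (λ { refl → t~w }) t∈T
      z∂ : ∀ {z} → z ∈ filter adjTo? Z → OnBoundary T z
      z∂ z∈ = let z∈Z , adjT = ∈-filter⁻ adjTo? z∈ in Z∉wT z∈Z ∘ there , adjT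
    new : suc (length (filter (∁? adjTo?) Z)) ≤ 3
    new = ≤-trans (unique-neighbours⇒length≤deg G (All.tabulate t≢ ∷ filter⁺ (∁? adjTo?) Z!)
                                                 (Adj-sym G t~w ∷ All.tabulate w~))
                  (deg≤3 w)
      where
      t≢ : ∀ {z} → z ∈ filter (∁? adjTo?) Z → t ≢ z
      t≢ z∈ refl = Z∉wT (proj₁ (∈-filter⁻ (∁? adjTo?) z∈)) (there t∈T)
      w~ : ∀ {z} → z ∈ filter (∁? adjTo?) Z → Adj G w z
      w~ z∈ with ∈-filter⁻ (∁? adjTo?) z∈
      ... | z∈Z , ¬adjT with proj₂ (All.lookup Z∂ z∈Z)
      ...   | here w~z   = w~z
      ...   | there adjT = contradiction adjT ¬adjT

  record Explored (S : VSet n) (u : Fin n) (T : List (Fin n)) : Set where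
    field
      unique    : Unique T
      root      : u ∈ T
      reachable : All (WalkIn G S u) T
      small     : SmallBoundary T

  explored-[_] : ∀ {S u} → S u → Explored S u (u ∷ [])
  explored-[ Su ] = record
    { unique = [] ∷ [] ; root = here refl ; reachable = here Su ∷ [] ; small = smallBoundary-[ _ ] }

  explore : ∀ {S u T x y} → Explored S u T → x ∈ T → WalkIn G S x y →
    ∃[ T′ ] (Explored S u T′ × T ⊆ T′ × y ∈ T′)
  explore ex x∈T (here _) = _ , ex , (λ t∈ → t∈) , x∈T
  explore {T = T} {x} ex x∈T (step {w = w} _ x~w p) with w ∈? T
  ... | yes w∈T = explore ex w∈T p
  ... | no  w∉T =
        let T′ , ex′ , ⊆T′ , y∈T′ = explore grown (here refl) p
        in T′ , ex′ , ⊆T′ ∘ there , y∈T′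
    where
    open Explored ex
    grown : Explored _ _ (w ∷ T)
    grown = record
      { unique    = ¬Any⇒All¬ T w∉T ∷ unique
      ; root      = there root
      ; reachable = walk-snoc G (All.lookup reachable x∈T) x~w (walk-start G p) ∷ reachable
      ; small     = smallBoundary-∷ w∉T x∈T x~w small
      }

  Reaches : VSet n → Fin n → VSet n
  Reaches S u y = ∃[ p ] (WalkIn G S u p × Adj G p y)

  boundary-bound : ∀ {S u ys} → S u → Unique ys → All (λ y → ¬ S y × Reaches S u y) ys →
    ∃[ T ] (Unique T × All (WalkIn G S u) T × length ys ≤ length T + 2)
  boundary-bound {S} {u} {ys} Su ys! ys∂ =
    let T , ex , ys~T = spanning ys (All.map proj₂ ys∂)
        open Explored ex
        outside : ∀ {y} → ¬ S y → y ∉ T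
        outside ¬Sy y∈T = ¬Sy (walk-end G (All.lookup reachable y∈T))
    in T , unique , reachable , small ys! (All.zipWith (λ ((¬Sy , _) , y~T) → outside ¬Sy , y~T) (ys∂ , ys~T))
    where
    spanning : ∀ zs → All (Reaches S u) zs → ∃[ T ] (Explored S u T × All (AdjTo T) zs)
    spanning []       []                       = u ∷ [] , explored-[ Su ] , []
    spanning (z ∷ zs) ((p , u⇝p , p~z) ∷ rest) =
      let T , ex , zs~T = spanning zs rest
          T′ , ex′ , T⊆T′ , p∈T′ = explore ex (Explored.root ex) u⇝p
      in T′ , ex′ , Any.map (λ { refl → p~z }) p∈T′ ∷ All.map (Any-resp-⊆ T⊆T′) zs~T

-- Universal vertices

Universal : ∀ {n} → Graph n → Fin n → Set
Universal G v = ∀ w → w ≢ v → Adj G v w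

module _ {n} (G : Graph n) where

  open import Data.List.Membership.DecPropositional (_≟_ {n = n}) using (_∈?_)

  universal⇒connDom : ∀ {S p} → S p → (∀ {w} → S w → w ≡ p) → Universal G p → ConnDom G S
  universal⇒connDom {S} {p} Sp S⊆p univ = dominating , connected
    where
    dominating : Dominating G S
    dominating w with w ≟ p
    ... | yes refl = inj₁ Sp
    ... | no  w≢p  = inj₂ (p , Sp , univ w w≢p)
    connected : ConnectedIn G S
    connected u w Su Sw with S⊆p {u} Su | S⊆p {w} Sw
    ... | refl | refl = here Su

  connectedIn-⊆edge : ∀ {S p q} → Adj G p q → (∀ {w} → S w → w ≡ p ⊎ w ≡ q) → ConnectedIn G S
  connectedIn-⊆edge p~q S⊆pq u w Su Sw with S⊆pq {u} Su | S⊆pq {w} Sw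
  ... | inj₁ refl | inj₁ refl = here Su
  ... | inj₂ refl | inj₂ refl = here Su
  ... | inj₁ refl | inj₂ refl = step Su p~q (here Sw)
  ... | inj₂ refl | inj₁ refl = step Su (Adj-sym G p~q) (here Sw)

  universal-cover : ∀ {v ps} → Universal G v → deg G v ≤ length ps → Unique (v ∷ ps) → ∀ w → w ∈ v ∷ ps
  universal-cover {v} {ps} univ deg≤ (v≢ps ∷ ps!) w with w ∈? v ∷ ps
  ... | yes w∈ = w∈
  ... | no  w∉ = contradiction (≤-trans (unique-neighbours⇒length≤deg G w∷ps! v~w∷ps) deg≤) (<⇒≱ ≤-refl)
    where
    w∷ps! : Unique (w ∷ ps)
    w∷ps! = ¬Any⇒All¬ ps (w∉ ∘ there) ∷ ps!
    v~w∷ps : All (Adj G v) (w ∷ ps)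
    v~w∷ps = univ w (w∉ ∘ here) ∷ All.tabulate (λ p∈ → univ _ λ { refl → All.lookup v≢ps p∈ refl })

module UniversalVertex {n} (G : Graph n) (deg≤3 : ∀ u → deg G u ≤ 3) {v} (univ : Universal G v) where

  open import Data.List.Membership.DecPropositional (_≟_ {n = n}) using (_∈?_)

  private
    module Oriented {A B : VSet n} (A∩B=∅ : ∀ {w} → A w → ¬ B w) (v∉A : ¬ A v) (v∉B : ¬ B v)
      (cd : ConnDom G (A ∪ B)) {a b} (Aa : A a) (Bb : B b) (a~b : Adj G a b) where

      a≢v : a ≢ v
      a≢v refl = v∉A Aa

      a≢b : a ≢ b
      a≢b refl = A∩B=∅ Aa Bb

      singleton : ∀ {xs} → (∀ w → w ∈ v ∷ a ∷ b ∷ xs) → All (λ x → ¬ A x × Adj G a x) xs → ConnDom G A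
      singleton cover rest = universal⇒connDom G Aa a-only a-universal
        where
        a-only : ∀ {w} → A w → w ≡ a
        a-only {w} Aw with cover w
        ... | here refl                  = contradiction Aw v∉A
        ... | there (here refl)          = refl
        ... | there (there (here refl))  = contradiction Bb (A∩B=∅ Aw)
        ... | there (there (there w∈xs)) = contradiction Aw (proj₁ (All.lookup rest w∈xs))
        a-universal : Universal G a
        a-universal w w≢a with cover w
        ... | here refl                  = Adj-sym G (univ a a≢v)
        ... | there (here refl)          = contradiction refl w≢a
        ... | there (there (here refl))  = a~b
        ... | there (there (there w∈xs)) = proj₂ (All.lookup rest w∈xs)

      module _ {x} (x≢v : x ≢ v) (x≢a : x ≢ a) (x≢b : x ≢ b) where

        cover : ∀ w → w ∈ v ∷ a ∷ b ∷ x ∷ []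
        cover = universal-cover G univ (deg≤3 v)
          (  (a≢v ∘ sym ∷ (λ { refl → v∉B Bb }) ∷ x≢v ∘ sym ∷ [])
          ∷ (a≢b ∷ x≢a ∘ sym ∷ [])
          ∷ (x≢b ∘ sym ∷ [])
          ∷ [] ∷ [])

        pair : A x → ¬ Adj G b x → ConnDom G A
        pair Ax ¬b~x = dominating , connectedIn-⊆edge G a~x A⊆ax
          where
          a~x : Adj G a x
          a~x with connDom⇒neighbour G cd (inj₂ Bb) x≢b
          ... | w , ABw , x~w with cover w
          ...   | here refl                         = contradiction ABw [ v∉A , v∉B ]
          ...   | there (here refl)                 = Adj-sym G x~w
          ...   | there (there (here refl))         = contradiction (Adj-sym G x~w) ¬b~x
          ...   | there (there (there (here refl))) = contradiction x~w (Adj-irrefl G)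
          dominating : Dominating G A
          dominating w with cover w
          ... | here refl                         = inj₂ (a , Aa , Adj-sym G (univ a a≢v))
          ... | there (here refl)                 = inj₁ Aa
          ... | there (there (here refl))         = inj₂ (a , Aa , a~b)
          ... | there (there (there (here refl))) = inj₁ Ax
          A⊆ax : ∀ {w} → A w → w ≡ a ⊎ w ≡ x
          A⊆ax {w} Aw with cover w
          ... | here refl                         = contradiction Aw v∉A
          ... | there (here refl)                 = inj₁ refl
          ... | there (there (here refl))         = contradiction Bb (A∩B=∅ Aw)
          ... | there (there (there (here refl))) = inj₂ refl

        dominated : ¬ A x → ¬ B x → Adj G a x ⊎ Adj G b x
        dominated ¬Ax ¬Bx with proj₁ cd x
        ... | inj₁ ABx = contradiction ABx [ ¬Ax , ¬Bx ]
        ... | inj₂ (w , ABw , w~x) with cover w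
        ...   | here refl                         = contradiction ABw [ v∉A , v∉B ]
        ...   | there (here refl)                 = inj₁ w~x
        ...   | there (there (here refl))         = inj₂ w~x
        ...   | there (there (there (here refl))) = contradiction w~x (Adj-irrefl G)

    -- Besides v there are at most three vertices, so A or B is a single universal vertex or a dominating edge.
    around-edge : ∀ {A B : VSet n} → Decidable A → Decidable B → (∀ {w} → A w → ¬ B w) →
      ¬ A v → ¬ B v → ConnDom G (A ∪ B) → ∀ {a b} → A a → B b → Adj G a b → ConnDom G A ⊎ ConnDom G B
    around-edge {A} {B} A? B? A∩B=∅ v∉A v∉B cd {a} {b} Aa Bb a~b = case all? (_∈? v ∷ a ∷ b ∷ []) of λ where
        (yes cover) → inj₁ (AB.singleton cover [])
        (no ¬cover) → let _ , x∉ = ¬∀⟶∃¬ n _ (_∈? v ∷ a ∷ b ∷ []) ¬cover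
                      in fourth (x∉ ∘ here) (x∉ ∘ there ∘ here) (x∉ ∘ there ∘ there ∘ here)
      where
      module AB = Oriented A∩B=∅ v∉A v∉B cd Aa Bb a~b
      module BA = Oriented (λ Bw Aw → A∩B=∅ Aw Bw) v∉B v∉A (connDom-≐ G [ inj₂ , inj₁ ] [ inj₂ , inj₁ ] cd)
                           Bb Aa (Adj-sym G a~b)
      fourth : ∀ {x} → x ≢ v → x ≢ a → x ≢ b → ConnDom G A ⊎ ConnDom G B
      fourth {x} x≢v x≢a x≢b with A? x | B? x | adj? G a x | adj? G b x
      ... | yes Ax | _      | _       | yes b~x = inj₂ (BA.singleton (BA.cover x≢v x≢b x≢a) ((A∩B=∅ Ax , b~x) ∷ []))
      ... | yes Ax | _      | _       | no ¬b~x = inj₁ (AB.pair x≢v x≢a x≢b Ax ¬b~x)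
      ... | no ¬Ax | _      | yes a~x | _       = inj₁ (AB.singleton (AB.cover x≢v x≢a x≢b) ((¬Ax , a~x) ∷ []))
      ... | no ¬Ax | yes Bx | no ¬a~x | _       = inj₂ (BA.pair x≢v x≢b x≢a Bx ¬a~x)
      ... | no ¬Ax | no ¬Bx | no ¬a~x | _       with AB.dominated x≢v x≢a x≢b ¬Ax ¬Bx
      ...   | inj₁ a~x = contradiction a~x ¬a~x
      ...   | inj₂ b~x = inj₂ (BA.singleton (BA.cover x≢v x≢b x≢a) ((¬Bx , b~x) ∷ []))

  universal-coalition : ∀ {A B : VSet n} → Decidable A → Decidable B → (∀ {w} → A w → ¬ B w) →
    ¬ A v → ¬ B v → ∀ {a b} → A a → B b → ConnDom G (A ∪ B) → ConnDom G A ⊎ ConnDom G B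
  universal-coalition A? B? A∩B=∅ v∉A v∉B Aa Bb cd
    with walk-exit G A? (λ _ _ Aq → Aq) (proj₂ cd _ _ (inj₁ Aa) (inj₂ Bb)) Aa (λ Ab → A∩B=∅ Ab Bb)
  ... | _ , _ , _   , _     , inj₁ Ab′ , ¬Ab′ = contradiction Ab′ ¬Ab′
  ... | _ , _ , Aa′ , a′~b′ , inj₂ Bb′ , _    = around-edge A? B? A∩B=∅ v∉A v∉B cd Aa′ Bb′ a′~b′

-- Graphs without two disjoint edges

disjoint-edges⇒matching₂ : ∀ {k} (E : Fin k → Fin k → Set) {a b c d} →
  E a b → E c d → a ≢ c → a ≢ d → b ≢ c → b ≢ d → HasMatching E 2
disjoint-edges⇒matching₂ {k} E {a} {b} {c} {d} ab cd a≢c a≢d b≢c b≢d = edge , is-edge , disjoint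
  where
  edge : Fin 2 → Fin k × Fin k
  edge zero       = a , b
  edge (suc zero) = c , d
  is-edge : ∀ t → E (proj₁ (edge t)) (proj₂ (edge t))
  is-edge zero       = ab
  is-edge (suc zero) = cd
  disjoint : ∀ t t′ → t ≢ t′ → proj₁ (edge t) ≢ proj₁ (edge t′) × proj₁ (edge t) ≢ proj₂ (edge t′)
                             × proj₂ (edge t) ≢ proj₁ (edge t′) × proj₂ (edge t) ≢ proj₂ (edge t′)
  disjoint zero       zero       t≢t = contradiction refl t≢t
  disjoint zero       (suc zero) _   = a≢c , a≢d , b≢c , b≢d
  disjoint (suc zero) zero       _   = a≢c ∘ sym , b≢c ∘ sym , a≢d ∘ sym , b≢d ∘ sym
  disjoint (suc zero) (suc zero) t≢t = contradiction refl t≢t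

transpose-matchˡ : ∀ {k} (i j : Fin k) → PC.transpose i j i ≡ j
transpose-matchˡ i j with i ≟ i
... | yes _   = refl
... | no  i≢i = contradiction refl i≢i

StarCentre : ∀ {k} → (Fin k → Fin k → Set) → Fin k → Set
StarCentre E c = (∀ j → j ≢ c → E c j) × (∀ {i j} → E i j → i ≡ c ⊎ j ≡ c)

star-iso : ∀ {k} {E : Fin (suc k) → Fin (suc k) → Set} → (∀ {i j} → E i j → E j i) → (∀ {i} → ¬ E i i) →
  ∀ {c} → StarCentre E c → Iso E (Star (suc k))
star-iso {E = E} E-sym E-irrefl {c} (spokes , through-c) = transpose c zero , λ i j → mk⇔ (to i j) (from i j)
  where
  τ : Fin _ → Fin _
  τ = PC.transpose c zero
  τ-injective : ∀ {i j} → τ i ≡ τ j → i ≡ j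
  τ-injective = Injection.injective (↔⇒↣ (transpose c zero))
  τ≡0⇔≡c : ∀ {i} → toℕ (τ i) ≡ 0 ⇔ i ≡ c
  τ≡0⇔≡c = mk⇔ (λ τi≡0 → τ-injective (trans (toℕ-injective τi≡0) (sym (transpose-matchˡ c zero))))
               (λ { refl → cong toℕ (transpose-matchˡ c zero) })
  to : ∀ i j → E i j → Star (suc _) (τ i) (τ j)
  to i j e = (λ τi≡τj → E-irrefl (subst (E i) (sym (τ-injective τi≡τj)) e))
           , Sum.map (Equivalence.from τ≡0⇔≡c) (Equivalence.from τ≡0⇔≡c) (through-c e)
  from : ∀ i j → Star (suc _) (τ i) (τ j) → E i j
  from i j (τi≢τj , inj₁ τi≡0) with Equivalence.to (τ≡0⇔≡c {i}) τi≡0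
  ... | refl = spokes j (λ { refl → τi≢τj refl })
  from i j (τi≢τj , inj₂ τj≡0) with Equivalence.to (τ≡0⇔≡c {j}) τj≡0
  ... | refl = E-sym (spokes i (λ { refl → τi≢τj refl }))

module SimpleGraph {k} {E : Fin k → Fin k → Set}
  (E-sym : ∀ {i j} → E i j → E j i) (E-irrefl : ∀ {i} → ¬ E i i) where

  E⇒≢ : ∀ {i j} → E i j → i ≢ j
  E⇒≢ e refl = E-irrefl e

  complete⇒iso-K : ∀ {m} → (∀ {i j} → i ≢ j → E i j) → Fin k ↔ Fin m → Iso E (K m)
  complete⇒iso-K complete f = f , λ i j →
    mk⇔ (λ e → E⇒≢ e ∘ Injection.injective (↔⇒↣ f)) (λ ne → complete (ne ∘ cong (Inverse.to f)))

  triangle-iso : ∀ {a b x} → a ≢ b → a ≢ x → b ≢ x → (∀ z → z ∈ a ∷ b ∷ x ∷ []) →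
    E a b → E a x → E b x → Iso E (K 3)
  triangle-iso {a} {b} {x} a≢b a≢x b≢x cover ab ax bx =
    complete⇒iso-K complete (↔-sym (⤖⇒↔ (mk⤖ (vertex-injective , vertex-surjective))))
    where
    vertex : Fin 3 → Fin k
    vertex = lookup (a ∷ b ∷ x ∷ [])
    vertex-injective : ∀ {s t} → vertex s ≡ vertex t → s ≡ t
    vertex-injective {zero}             {zero}             _ = refl
    vertex-injective {suc zero}         {suc zero}         _ = refl
    vertex-injective {suc (suc zero)}   {suc (suc zero)}   _ = refl
    vertex-injective {zero}             {suc zero}         e = contradiction e a≢b
    vertex-injective {zero}             {suc (suc zero)}   e = contradiction e a≢x
    vertex-injective {suc zero}         {zero}             e = contradiction (sym e) a≢b
    vertex-injective {suc zero}         {suc (suc zero)}   e = contradiction e b≢x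
    vertex-injective {suc (suc zero)}   {zero}             e = contradiction (sym e) a≢x
    vertex-injective {suc (suc zero)}   {suc zero}         e = contradiction (sym e) b≢x
    vertex-surjective : ∀ z → ∃ λ s → ∀ {t} → t ≡ s → vertex t ≡ z
    vertex-surjective z = Any.index (cover z) , λ { refl → sym (lookup-index (cover z)) }
    complete : ∀ {i j} → i ≢ j → E i j
    complete {i} {j} i≢j with cover i | cover j
    ... | here refl                 | here refl                 = contradiction refl i≢j
    ... | there (here refl)         | there (here refl)         = contradiction refl i≢j
    ... | there (there (here refl)) | there (there (here refl)) = contradiction refl i≢j
    ... | here refl                 | there (here refl)         = ab
    ... | here refl                 | there (there (here refl)) = ax
    ... | there (here refl)         | there (there (here refl)) = bx
    ... | there (here refl)         | here refl                 = E-sym ab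
    ... | there (there (here refl)) | here refl                 = E-sym ax
    ... | there (there (here refl)) | there (here refl)         = E-sym bx


module MatchingNumberOne {k} {E : Fin k → Fin k → Set} (E? : ∀ i j → Dec (E i j))
  (E-sym : ∀ {i j} → E i j → E j i) (E-irrefl : ∀ {i} → ¬ E i i)
  (partner : ∀ i → ∃[ j ] E i j) (maximum : ∀ m → HasMatching E m → m ≤ 1) where

  open SimpleGraph {E = E} E-sym E-irrefl

  no-disjoint-edges : ∀ {a b c d} → E a b → E c d → a ≢ c → a ≢ d → b ≢ c → b ≢ d → ⊥
  no-disjoint-edges ab cd a≢c a≢d b≢c b≢d with maximum 2 (disjoint-edges⇒matching₂ E ab cd a≢c a≢d b≢c b≢d)
  ... | s≤s ()

  attach : ∀ {a b x} → E a b → x ≢ a → x ≢ b → E x a ⊎ E x b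
  attach {a} {b} {x} ab x≢a x≢b with partner x
  ... | p , xp with p ≟ a | p ≟ b
  ...   | yes refl | _        = inj₁ xp
  ...   | no _     | yes refl = inj₂ xp
  ...   | no p≢a   | no p≢b   = ⊥-elim (no-disjoint-edges xp ab x≢a x≢b p≢a p≢b)

  star-centre : ∀ {a b} → E a b → (∀ {x} → x ≢ a → x ≢ b → ¬ E x b) → StarCentre E a
  star-centre {a} {b} ab b-leaf = spokes , through-a
    where
    spokes : ∀ j → j ≢ a → E a j
    spokes j j≢a with j ≟ b
    ... | yes refl = ab
    ... | no  j≢b  = [ E-sym , (λ jb → contradiction jb (b-leaf j≢a j≢b)) ] (attach ab j≢a j≢b)
    through-a : ∀ {i j} → E i j → i ≡ a ⊎ j ≡ a
    through-a {i} {j} e with i ≟ a | j ≟ a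
    ... | yes i≡a | _       = inj₁ i≡a
    ... | no _    | yes j≡a = inj₂ j≡a
    ... | no i≢a  | no j≢a with i ≟ b | j ≟ b
    ...   | yes refl | _        = ⊥-elim (b-leaf j≢a (E⇒≢ e ∘ sym) (E-sym e))
    ...   | no _     | yes refl = ⊥-elim (b-leaf i≢a (E⇒≢ e) e)
    ...   | no i≢b   | no j≢b   = ⊥-elim (no-disjoint-edges e ab i≢a i≢b j≢a j≢b)

  triangle-or-star : ∀ {a b} → E a b → Iso E (K 3) ⊎ ∃ (StarCentre E)
  triangle-or-star {a} {b} ab with any? (λ x → ¬? (x ≟ a) ×-dec ¬? (x ≟ b) ×-dec E? x b)
  ... | no ¬b-edge = inj₂ (a , star-centre ab λ x≢a x≢b xb → ¬b-edge (_ , x≢a , x≢b , xb))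
  ... | yes (y , y≢a , y≢b , yb) with any? (λ x → ¬? (x ≟ a) ×-dec ¬? (x ≟ b) ×-dec E? x a)
  ...   | no ¬a-edge = inj₂ (b , star-centre (E-sym ab) λ x≢b x≢a xa → ¬a-edge (_ , x≢a , x≢b , xa))
  ...   | yes (x , x≢a , x≢b , xa) with x ≟ y
  ...     | no x≢y   = ⊥-elim (no-disjoint-edges xa yb x≢y x≢b (y≢a ∘ sym) (E⇒≢ ab))
  ...     | yes refl = inj₁ (triangle-iso (E⇒≢ ab) (x≢a ∘ sym) (x≢b ∘ sym) cover ab (E-sym xa) (E-sym yb))
    where
    cover : ∀ z → z ∈ a ∷ b ∷ x ∷ []
    cover z with z ≟ a | z ≟ b | z ≟ x
    ... | yes refl | _        | _        = here refl
    ... | no _     | yes refl | _        = there (here refl)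
    ... | no _     | no _     | yes refl = there (there (here refl))
    ... | no z≢a   | no z≢b   | no z≢x   with attach ab z≢a z≢b
    ...   | inj₁ za = ⊥-elim (no-disjoint-edges za yb z≢x z≢b (x≢a ∘ sym) (E⇒≢ ab))
    ...   | inj₂ zb = ⊥-elim (no-disjoint-edges zb xa z≢x z≢a (x≢b ∘ sym) (E⇒≢ ab ∘ sym))

-- Counting the leaves of a star

private
  m≤3⇒2+m≤n⇒3*m≤n+4 : ∀ {m n} → m ≤ 3 → 2 + m ≤ n → 3 * m ≤ n + 4
  m≤3⇒2+m≤n⇒3*m≤n+4 {m} {n} m≤3 2+m≤n = begin
    3 * m             ≤⟨ +-monoʳ-≤ m (+-mono-≤ m≤3 (+-monoˡ-≤ 0 m≤3)) ⟩
    m + (3 + (3 + 0)) ≡⟨ rearrange m ⟩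
    2 + m + 4         ≤⟨ +-monoˡ-≤ 4 2+m≤n ⟩
    n + 4             ∎
    where
    open ≤-Reasoning
    rearrange : ∀ m → m + (3 + (3 + 0)) ≡ 2 + m + 4
    rearrange = solve-∀

  m≤a+2⇒m≤b+2⇒a+b+m≤n⇒3*m≤n+4 : ∀ {m a b n} → m ≤ a + 2 → m ≤ b + 2 → a + (b + m) ≤ n → 3 * m ≤ n + 4
  m≤a+2⇒m≤b+2⇒a+b+m≤n⇒3*m≤n+4 {m} {a} {b} {n} m≤a+2 m≤b+2 a+b+m≤n = begin
    3 * m                     ≤⟨ +-mono-≤ m≤a+2 (+-mono-≤ m≤b+2 (≤-reflexive (+-identityʳ m))) ⟩
    a + 2 + (b + 2 + m)       ≡⟨ rearrange a b m ⟩
    a + (b + m) + 4           ≤⟨ +-monoˡ-≤ 4 a+b+m≤n ⟩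
    n + 4                     ∎
    where
    open ≤-Reasoning
    rearrange : ∀ a b m → a + 2 + (b + 2 + m) ≡ a + (b + m) + 4
    rearrange = solve-∀

module LeafBound {n} (G : Graph n) (deg≤3 : ∀ u → deg G u ≤ 3)
  {C : VSet n} (C? : Decidable C) {c₀} (c₀∈C : C c₀) (¬cdC : ¬ ConnDom G C)
  {m} (L : Fin m → VSet n) (L-disjoint : ∀ {i j y} → L i y → L j y → i ≡ j) (L∩C=∅ : ∀ {j y} → L j y → ¬ C y)
  (cd : ∀ j → ConnDom G (C ∪ L j)) where

  open Boundary G deg≤3

  private
    in-L : ∀ {j y} → (C ∪ L j) y → ¬ C y → L j y
    in-L (inj₁ Cy) ¬Cy = contradiction Cy ¬Cy
    in-L (inj₂ Ly) _   = Ly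

    tabulate-unique : (f : Fin m → Fin n) → (∀ j → L j (f j)) → Unique (tabulate f)
    tabulate-unique f f∈L = tabulate⁺ λ {i} {j} fi≡fj → L-disjoint (f∈L i) (subst (L j) (sym fi≡fj) (f∈L j))

  undominated-bound : ∀ {x} → ¬ C x → (∀ {u} → C u → ¬ Adj G u x) → 3 * m ≤ n + 4
  undominated-bound {x} ¬Cx undominated = m≤3⇒2+m≤n⇒3*m≤n+4 m≤3 2+m≤n
    where
    x≢c₀ : x ≢ c₀
    x≢c₀ refl = ¬Cx c₀∈C
    neighbour : ∀ j → ∃[ w ] (L j w × Adj G x w)
    neighbour j with connDom⇒neighbour G (cd j) (inj₁ c₀∈C) x≢c₀
    ... | w , CLw , x~w = w , in-L CLw (λ Cw → undominated Cw (Adj-sym G x~w)) , x~w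
    w : Fin m → Fin n
    w = proj₁ ∘ neighbour
    w∈L : ∀ j → L j (w j)
    w∈L = proj₁ ∘ proj₂ ∘ neighbour
    x~w : ∀ j → Adj G x (w j)
    x~w = proj₂ ∘ proj₂ ∘ neighbour
    ws! : Unique (tabulate w)
    ws! = tabulate-unique w w∈L
    m≤3 : m ≤ 3
    m≤3 = subst (_≤ 3) (length-tabulate w)
      (≤-trans (unique-neighbours⇒length≤deg G ws! (All-tabulate⁺ x~w)) (deg≤3 x))
    2+m≤n : 2 + m ≤ n
    2+m≤n = subst (λ l → 2 + l ≤ n) (length-tabulate w)
      (unique⇒length≤ ((x≢c₀ ∘ sym ∷ All-tabulate⁺ c₀≢w) ∷ All-tabulate⁺ x≢w ∷ ws!))
      where
      c₀≢w : ∀ j → c₀ ≢ w j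
      c₀≢w j c₀≡w = L∩C=∅ (w∈L j) (subst C c₀≡w c₀∈C)
      x≢w : ∀ j → x ≢ w j
      x≢w j x≡w = Adj-irrefl G (subst (Adj G x) (sym x≡w) (x~w j))

  -- Every L j meets the boundary of the C-component of u, since C ∪ L j connects u to u′.
  exits : ∀ {u u′} → C u → C u′ → ¬ WalkIn G C u u′ →
    ∃[ ys ] (length ys ≡ m × Unique ys × All (λ y → ¬ C y × Reaches C u y) ys)
  exits {u} {u′} Cu Cu′ ¬u⇝u′ = tabulate (proj₁ ∘ exit) , length-tabulate _
    , tabulate-unique _ (proj₁ ∘ proj₂ ∘ exit) , All-tabulate⁺ (proj₂ ∘ proj₂ ∘ exit)
    where
    exit : ∀ j → ∃[ y ] (L j y × ¬ C y × Reaches C u y)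
    exit j with walk-exit G C? (λ u⇝p p~q Cq → walk-snoc G u⇝p p~q Cq)
                  (proj₂ (cd j) u u′ (inj₁ Cu) (inj₁ Cu′)) (here Cu) ¬u⇝u′
    ... | p , y , u⇝p , p~y , CLy , ¬Cy = y , in-L CLy ¬Cy , ¬Cy , p , u⇝p , p~y

  component-bound : ∀ {u u′} → C u → C u′ → ¬ WalkIn G C u u′ →
    ∃[ T ] (Unique T × All (WalkIn G C u) T × m ≤ length T + 2)
  component-bound Cu Cu′ ¬u⇝u′ =
    let ys , |ys|≡m , ys! , ys∂ = exits Cu Cu′ ¬u⇝u′
        T , T! , T⇝ , |ys|≤T+2 = boundary-bound Cu ys! ys∂
    in T , T! , T⇝ , subst (_≤ length T + 2) |ys|≡m |ys|≤T+2

  two-components-count : ∀ {u₁ u₂ T₁ T₂ ys} → ¬ WalkIn G C u₁ u₂ →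
    Unique T₁ → All (WalkIn G C u₁) T₁ → Unique T₂ → All (WalkIn G C u₂) T₂ → Unique ys → All (¬_ ∘ C) ys →
    length T₁ + (length T₂ + length ys) ≤ n
  two-components-count {T₁ = T₁} {T₂} {ys} ¬u₁⇝u₂ T₁! T₁⇝ T₂! T₂⇝ ys! ys∉C =
    subst (_≤ n) (trans (length-++ T₁) (cong (length T₁ +_) (length-++ T₂)))
      (unique⇒length≤ (++⁺ T₁! (++⁺ T₂! ys! T₂∩ys=∅) T₁∩rest=∅))
    where
    T₂∩ys=∅ : Disjoint T₂ ys
    T₂∩ys=∅ (v∈T₂ , v∈ys) = All.lookup ys∉C v∈ys (walk-end G (All.lookup T₂⇝ v∈T₂))
    T₁∩rest=∅ : Disjoint T₁ (T₂ ++ ys)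
    T₁∩rest=∅ (v∈T₁ , v∈rest) with ∈-++⁻ T₂ v∈rest
    ... | inj₁ v∈T₂ = ¬u₁⇝u₂ (walk-++ G (All.lookup T₁⇝ v∈T₁) (walk-reverse G (All.lookup T₂⇝ v∈T₂)))
    ... | inj₂ v∈ys = All.lookup ys∉C v∈ys (walk-end G (All.lookup T₁⇝ v∈T₁))

  disconnected-bound : ∀ {u₁ u₂} → C u₁ → C u₂ → ¬ WalkIn G C u₁ u₂ → 3 * m ≤ n + 4
  disconnected-bound Cu₁ Cu₂ ¬u₁⇝u₂ =
    let T₁ , T₁! , T₁⇝ , m≤T₁+2 = component-bound Cu₁ Cu₂ ¬u₁⇝u₂
        T₂ , T₂! , T₂⇝ , m≤T₂+2 = component-bound Cu₂ Cu₁ (¬u₁⇝u₂ ∘ walk-reverse G)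
        ys , |ys|≡m , ys! , ys∂ = exits Cu₁ Cu₂ ¬u₁⇝u₂
    in m≤a+2⇒m≤b+2⇒a+b+m≤n⇒3*m≤n+4 m≤T₁+2 m≤T₂+2
         (subst (λ l → length T₁ + (length T₂ + l) ≤ n) |ys|≡m
           (two-components-count ¬u₁⇝u₂ T₁! T₁⇝ T₂! T₂⇝ ys! (All.map proj₁ ys∂)))

  leaf-bound : 3 * m ≤ n + 4
  leaf-bound with ¬connDom⇒witness G C? ¬cdC
  ... | inj₁ (_ , ¬Cx , undominated)          = undominated-bound ¬Cx undominated
  ... | inj₂ (_ , _ , Cu₁ , Cu₂ , ¬u₁⇝u₂) = disconnected-bound Cu₁ Cu₂ ¬u₁⇝u₂

3*m≤n+4⇒1+m≤[n+7]/3 : ∀ {m n} → 3 * m ≤ n + 4 → suc m ≤ (n + 7) / 3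
3*m≤n+4⇒1+m≤[n+7]/3 {m} {n} 3m≤n+4 = begin
  suc m             ≡⟨ m*n/n≡m (suc m) 3 ⟨
  suc m * 3 / 3     ≤⟨ /-monoˡ-≤ 3 (begin
    suc m * 3         ≡⟨ rearrange m ⟩
    3 * m + 3         ≤⟨ +-monoˡ-≤ 3 3m≤n+4 ⟩
    n + 4 + 3         ≡⟨ +-assoc n 4 3 ⟩
    n + 7             ∎) ⟩
  (n + 7) / 3       ∎
  where
  open ≤-Reasoning
  rearrange : ∀ m → suc m * 3 ≡ 3 * m + 3
  rearrange = solve-∀

-- The connected coalition graph

module _ {n k} (π : Partition n k) where

  block? : ∀ i → Decidable (Block π i)
  block? i v = part π v ≟ i

  blocks-disjoint : ∀ {i j v} → Block π i v → Block π j v → i ≡ j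
  blocks-disjoint v∈i v∈j = trans (sym v∈i) v∈j

module _ {n k} (G : Graph n) (π : Partition n k) where

  ccg? : ∀ i j → Dec (CCG G π i j)
  ccg? i j = ¬? (connDom? G (block? π i)) ×-dec ¬? (connDom? G (block? π j))
           ×-dec connDom? G (λ v → block? π i v ⊎-dec block? π j v)

  ccg-sym : ∀ {i j} → CCG G π i j → CCG G π j i
  ccg-sym (¬cd-i , ¬cd-j , cd) = ¬cd-j , ¬cd-i , connDom-≐ G [ inj₂ , inj₁ ] [ inj₂ , inj₁ ] cd

  ccg-irrefl : ∀ {i} → ¬ CCG G π i i
  ccg-irrefl (¬cd-i , _ , cd) = ¬cd-i (connDom-≐ G [ id , id ] inj₁ cd)

  -- A singleton connected dominating block is a universal vertex, which excludes every coalition.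
  ccg-partner : (∀ u → deg G u ≤ 3) → IsConnCoalitionPartition G π →
    ∀ {a b} → CCG G π a b → ∀ i → ∃[ j ] CCG G π i j
  ccg-partner deg≤3 ccp {a} {b} ab@(¬cd-a , ¬cd-b , cd) i with ccp i
  ... | inj₂ partner = partner
  ... | inj₁ (cd-i , v , singleton) = ⊥-elim ([ ¬cd-a , ¬cd-b ]
          (UniversalVertex.universal-coalition G deg≤3 universal (block? π a) (block? π b) a∩b=∅
            (not-in ¬cd-a) (not-in ¬cd-b) (proj₂ (nonempty π a)) (proj₂ (nonempty π b)) cd))
    where
    universal : Universal G v
    universal w w≢v with proj₁ cd-i w
    ... | inj₁ w∈i             = contradiction (proj₁ (singleton w) w∈i) w≢v
    ... | inj₂ (u , u∈i , u~w) = subst (λ u → Adj G u w) (proj₁ (singleton u) u∈i) u~w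
    not-in : ∀ {j} → ¬ ConnDom G (Block π j) → ¬ Block π j v
    not-in ¬cd-j v∈j = ¬cd-j (subst (ConnDom G ∘ Block π) (blocks-disjoint π (proj₂ (singleton v) refl) v∈j) cd-i)
    a∩b=∅ : ∀ {w} → Block π a w → ¬ Block π b w
    a∩b=∅ w∈a w∈b = ccg-irrefl (subst (CCG G π a) (sym (blocks-disjoint π w∈a w∈b)) ab)

star-case : ∀ {n k} (G : Graph n) (π : Partition n k) → (∀ u → deg G u ≤ 3) → ∀ {a b} → CCG G π a b →
  ∃ (StarCentre (CCG G π)) → Iso (CCG G π) (Star k) × k ≤ (n + 7) / 3
star-case {k = zero}  G π deg≤3 ab (() , _)
star-case {k = suc m} G π deg≤3 ab (c , spokes , through-c) =
  star-iso (ccg-sym G π) (ccg-irrefl G π) (spokes , through-c) ,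
  3*m≤n+4⇒1+m≤[n+7]/3 (LeafBound.leaf-bound G deg≤3 (block? π c) (proj₂ (nonempty π c)) ¬cd-c
    (Block π ∘ punchIn c) (λ y∈i y∈j → punchIn-injective c _ _ (blocks-disjoint π y∈i y∈j))
    (λ {j} y∈j y∈c → punchInᵢ≢i c j (blocks-disjoint π y∈j y∈c))
    (λ j → proj₂ (proj₂ (spokes (punchIn c j) (punchInᵢ≢i c j)))))
  where
  ¬cd-c : ¬ ConnDom G (Block π c)
  ¬cd-c = [ (λ { refl → proj₁ ab }) , (λ { refl → proj₁ (proj₂ ab) }) ] (through-c ab)

lemma5 : ∀ {n k} (G : Graph n) (π : Partition n k) → Subcubic G
    → IsConnCoalitionPartition G π → MatchingNumber (CCG G π) 1
    → Iso (CCG G π) (K 3) ⊎ (Iso (CCG G π) (Star k) × k ≤ (n + 7) / 3)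
lemma5 G π (_ , deg≤3) ccp ((edge , is-edge , _) , maximum) =
  Sum.map₂ (star-case G π deg≤3 ab) (triangle-or-star ab)
  where
  ab : CCG G π (proj₁ (edge zero)) (proj₂ (edge zero))
  ab = is-edge zero
  open MatchingNumberOne (ccg? G π) (ccg-sym G π) (ccg-irrefl G π) (ccg-partner G π deg≤3 ccp ab) maximum
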